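{- Let $\mathsf{L}$ be any extension of $\mathsf{IUL}^\star$ and let $\Sigma\cup\{\varphi_1,\dots,\varphi_n\}\subseteq\mathrm{Fm}_m$. If $\Sigma\vdash_{\mathsf{L}}\lambda_1\varphi_1+\dots+\lambda_n\varphi_n$ for some $\lambda_1,\dots,\lambda_n\in\mathbb{N}$ not all $0$, then $\Sigma\vdash_{\mathsf{L}}\varphi_1\lor\dots\lor\varphi_n$.
   Context: A logic over a propositional language $\mathcal{L}$ is a pair $\langle\mathcal{L},\vdash_{\mathsf{L}}\rangle$ where $\vdash_{\mathsf{L}}\subseteq\mathcal{P}(\mathrm{Fm}_{\mathcal{L}})\times\mathrm{Fm}_{\mathcal{L}}$ is a substitution-invariant consequence relation (reflexive, monotone, closed under cut and under substitutions) on the formulas $\mathrm{Fm}_{\mathcal{L}}$ over a fixed countably infinite set of variables; $\vdash_{\mathsf{L}}\varphi$ means $\emptyset\vdash_{\mathsf{L}}\varphi$. A logic $\mathsf{L}'$ is an extension of $\mathsf{L}$ if $\vdash_{\mathsf{L}}\subseteq\vdash_{\mathsf{L}'}$; for a set $X$ of formulas, $\mathsf{L}\oplus X$ is the smallest extension of $\mathsf{L}$ that includes $X$ (as theorems). The language $\mathcal{L}_m$ has binary connectives $\to,\cdot$ and constants $1,0$; set $\neg\varphi:=\varphi\to 0$, $\varphi+\psi:=\neg\varphi\to\psi$, $0\varphi:=0$, $(n+1)\varphi:=n\varphi+\varphi$, $\varphi^0:=1$, $\varphi^{n+1}:=\varphi^n\cdot\varphi$. Formulas of $\mathcal{L}_m$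 are called multiplicative; their set is $\mathrm{Fm}_m$. The language $\mathcal{L}_\ell$ additionally has binary $\land,\lor$. $\mathsf{MALL}^-$ is the logic over $\mathcal{L}_\ell$ given by the axiom schemas $(\varphi\to\psi)\to((\psi\to\chi)\to(\varphi\to\chi))$, $(\varphi\to(\psi\to\chi))\to(\psi\to(\varphi\to\chi))$, $\varphi\to\varphi$, $\neg\neg\varphi\to\varphi$, $(\varphi\to(\psi\to\chi))\to((\varphi\cdot\psi)\to\chi)$, $\varphi\to(\psi\to(\varphi\cdot\psi))$, $\varphi\to(1\to\varphi)$, $1$, $(\varphi\land\psi)\to\varphi$, $(\varphi\land\psi)\to\psi$, $\varphi\to(\varphi\lor\psi)$, $\psi\to(\varphi\lor\psi)$, $((\varphi\to\psi)\land(\varphi\to\chi))\to(\varphi\to(\psi\land\chi))$, $((\varphi\to\chi)\land(\psi\to\chi))\to((\varphi\lor\psi)\to\chi)$, and rules modus ponens and adjunction (from $\varphi,\psi$ infer $\varphi\land\psi$). $\mathsf{IUL}^-:=\mathsf{MALL}^-\oplus\{((p\to q)\land 1)\lor((q\to p)\land 1)\}$ and $\mathsf{IUL}^\star:=\mathsf{IUL}^-\oplus\{p\lor\neg p,\ 0\to 1\}$. -}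

module Defs where

open import Data.Nat using (ℕ; zero; suc)
open import Data.Fin using (Fin; zero; suc)
open import Data.Product using (Σ; _×_; ∃)
open import Relation.Binary.PropositionalEquality using (_≡_)

infixr 5 _⇒_
infixl 7 _·_
infixl 6 _∧_
infixl 6 _∨_

data Fm : Set where
  var : ℕ → Fm
  _⇒_ : Fm → Fm → Fm
  _·_ : Fm → Fm → Fm
  𝟏   : Fm
  𝟎   : Fm
  _∧_ : Fm → Fm → Fm
  _∨_ : Fm → Fm → Fm

data IsMult : Fm → Set where
  var : ∀ n → IsMult (var n)
  _⇒_ : ∀ {φ ψ} → IsMult φ → IsMult ψ → IsMult (φ ⇒ ψ)
  _·_ : ∀ {φ ψ} → IsMult φ → IsMult ψ → IsMult (φ · ψ)
  𝟏   : IsMult 𝟏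
  𝟎   : IsMult 𝟎

¬' : Fm → Fm
¬' φ = φ ⇒ 𝟎

_⊕_ : Fm → Fm → Fm
φ ⊕ ψ = ¬' φ ⇒ ψ

_⊗_ : ℕ → Fm → Fm
zero  ⊗ φ = 𝟎
suc n ⊗ φ = (n ⊗ φ) ⊕ φ

FmSet : Set₁
FmSet = Fm → Set

_⊆_ : FmSet → FmSet → Set
Γ ⊆ Δ = ∀ φ → Γ φ → Δ φ

Subst : Set
Subst = ℕ → Fm

sub : Subst → Fm → Fm
sub σ (var n) = σ n
sub σ (φ ⇒ ψ) = sub σ φ ⇒ sub σ ψ
sub σ (φ · ψ) = sub σ φ · sub σ ψ
sub σ 𝟏 = 𝟏
sub σ 𝟎 = 𝟎
sub σ (φ ∧ ψ) = sub σ φ ∧ sub σ ψ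
sub σ (φ ∨ ψ) = sub σ φ ∨ sub σ ψ

subSet : Subst → FmSet → FmSet
subSet σ Γ ψ = Σ Fm (λ χ → Γ χ × (ψ ≡ sub σ χ))

record IsLogic (_⊢_ : FmSet → Fm → Set) : Set₁ where
  field
    reflexive : ∀ {Γ φ} → Γ φ → Γ ⊢ φ
    monotone  : ∀ {Γ Δ φ} → Γ ⊆ Δ → Γ ⊢ φ → Δ ⊢ φ
    cut       : ∀ {Γ Δ φ} → (∀ ψ → Δ ψ → Γ ⊢ ψ) → Δ ⊢ φ → Γ ⊢ φ
    structural : ∀ {Γ φ} (σ : Subst) → Γ ⊢ φ → subSet σ Γ ⊢ sub σ φ

-- Hilbert calculus for IUL* = MALL⁻ ⊕ {prelinearity, p ∨ ¬p, 0 → 1}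
-- (the added axioms are taken with all their substitution instances).
data _⊢IUL⋆_ (Γ : FmSet) : Fm → Set where
  assm : ∀ {φ} → Γ φ → Γ ⊢IUL⋆ φ
  ax-sfx  : ∀ φ ψ χ → Γ ⊢IUL⋆ ((φ ⇒ ψ) ⇒ ((ψ ⇒ χ) ⇒ (φ ⇒ χ)))
  ax-perm : ∀ φ ψ χ → Γ ⊢IUL⋆ ((φ ⇒ (ψ ⇒ χ)) ⇒ (ψ ⇒ (φ ⇒ χ)))
  ax-id   : ∀ φ → Γ ⊢IUL⋆ (φ ⇒ φ)
  ax-dn   : ∀ φ → Γ ⊢IUL⋆ (¬' (¬' φ) ⇒ φ)
  ax-res  : ∀ φ ψ χ → Γ ⊢IUL⋆ ((φ ⇒ (ψ ⇒ χ)) ⇒ ((φ · ψ) ⇒ χ))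
  ax-fus  : ∀ φ ψ → Γ ⊢IUL⋆ (φ ⇒ (ψ ⇒ (φ · ψ)))
  ax-push : ∀ φ → Γ ⊢IUL⋆ (φ ⇒ (𝟏 ⇒ φ))
  ax-1    : Γ ⊢IUL⋆ 𝟏
  ax-∧l   : ∀ φ ψ → Γ ⊢IUL⋆ ((φ ∧ ψ) ⇒ φ)
  ax-∧r   : ∀ φ ψ → Γ ⊢IUL⋆ ((φ ∧ ψ) ⇒ ψ)
  ax-∨l   : ∀ φ ψ → Γ ⊢IUL⋆ (φ ⇒ (φ ∨ ψ))
  ax-∨r   : ∀ φ ψ → Γ ⊢IUL⋆ (ψ ⇒ (φ ∨ ψ))
  ax-∧i   : ∀ φ ψ χ → Γ ⊢IUL⋆ (((φ ⇒ ψ) ∧ (φ ⇒ χ)) ⇒ (φ ⇒ (ψ ∧ χ)))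
  ax-∨e   : ∀ φ ψ χ → Γ ⊢IUL⋆ (((φ ⇒ χ) ∧ (ψ ⇒ χ)) ⇒ ((φ ∨ ψ) ⇒ χ))
  ax-prl  : ∀ φ ψ → Γ ⊢IUL⋆ (((φ ⇒ ψ) ∧ 𝟏) ∨ ((ψ ⇒ φ) ∧ 𝟏))
  ax-em   : ∀ φ → Γ ⊢IUL⋆ (φ ∨ ¬' φ)
  ax-01   : Γ ⊢IUL⋆ (𝟎 ⇒ 𝟏)
  mp      : ∀ {φ ψ} → Γ ⊢IUL⋆ φ → Γ ⊢IUL⋆ (φ ⇒ ψ) → Γ ⊢IUL⋆ ψ
  adj     : ∀ {φ ψ} → Γ ⊢IUL⋆ φ → Γ ⊢IUL⋆ ψ → Γ ⊢IUL⋆ (φ ∧ ψ)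

record ExtendsIUL⋆ (_⊢_ : FmSet → Fm → Set) : Set₁ where
  field
    isLogic  : IsLogic _⊢_
    contains : ∀ {Γ φ} → Γ ⊢IUL⋆ φ → Γ ⊢ φ

-- Iterated binary connective over φ₁,…,φₙ (n ≥ 1), right-associated:
-- big op φ = φ₁ op (φ₂ op (… op φₙ)).
big : (Fm → Fm → Fm) → ∀ {m} → (Fin (suc m) → Fm) → Fm
big op {zero}  φ = φ zero
big op {suc m} φ = op (φ zero) (big op (λ i → φ (suc i)))

module Submission where

-- In IUL⋆ every formula a satisfies a ∨ (¬a ∧ 1): prelinearity of a and 0
-- gives (0 → a) ∧ 1 or (a → 0) ∧ 1, and excluded middle settles the first case.
-- Call S good for Y if every D ≤ 1 with D → S satisfies D → Y.  If a → Y and S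
-- is good for Y, so is ¬a → S: split on a ∨ (¬a ∧ 1); the first case gives Y,
-- and in the second D · (¬a ∧ 1) is again below 1 and implies S.  Since
-- n a + R implies ¬a → (n' a + R) for n = n' + 1, the summands of
-- λ₁φ₁ + … + λₙφₙ can be peeled off one at a time down to a single nonzero
-- multiple kφ, which implies φ.  Taking D = 1 then derives the disjunction
-- from the sum in IUL⋆ itself.

open import Defs
open import Data.Nat using (ℕ; zero; suc)
open import Data.Fin using (Fin; zero; suc)
open import Data.Product using (Σ; _,_)
open import Data.Sum using (_⊎_; inj₁; inj₂)
open import Data.Empty using (⊥-elim)
open import Relation.Binary.PropositionalEquality using (_≡_; _≢_; refl)

module _ {Γ : FmSet} where

  infix 2 ⊢_
  ⊢_ : Fm → Set
  ⊢ φ = Γ ⊢IUL⋆ φ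

  ⇒-trans : ∀ {A B C} → ⊢ A ⇒ B → ⊢ B ⇒ C → ⊢ A ⇒ C
  ⇒-trans p q = mp q (mp p (ax-sfx _ _ _))

  ⇒-exchange : ∀ {A B C} → ⊢ A ⇒ (B ⇒ C) → ⊢ B ⇒ (A ⇒ C)
  ⇒-exchange p = mp p (ax-perm _ _ _)

  ⇒-monoʳ : ∀ {A B C} → ⊢ B ⇒ C → ⊢ (A ⇒ B) ⇒ (A ⇒ C)
  ⇒-monoʳ p = mp p (⇒-exchange (ax-sfx _ _ _))

  ⇒-antitoneˡ : ∀ {A B C} → ⊢ A ⇒ B → ⊢ (B ⇒ C) ⇒ (A ⇒ C)
  ⇒-antitoneˡ p = mp p (ax-sfx _ _ _)

  ·-uncurry : ∀ {A B C} → ⊢ A ⇒ (B ⇒ C) → ⊢ (A · B) ⇒ C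
  ·-uncurry p = mp p (ax-res _ _ _)

  ·-curry : ∀ {A B C} → ⊢ (A · B) ⇒ C → ⊢ A ⇒ (B ⇒ C)
  ·-curry p = ⇒-trans (ax-fus _ _) (⇒-monoʳ p)

  ⇒-apply : ∀ A B → ⊢ A ⇒ ((A ⇒ B) ⇒ B)
  ⇒-apply A B = ⇒-exchange (ax-id (A ⇒ B))

  ⇒-weaken-subunit : ∀ {A E} → ⊢ E ⇒ 𝟏 → ⊢ A ⇒ (E ⇒ A)
  ⇒-weaken-subunit e = ⇒-trans (ax-push _) (⇒-antitoneˡ e)

  ∧-intro₂ : ∀ {A B C D} → ⊢ A ⇒ (B ⇒ C) → ⊢ A ⇒ (B ⇒ D) → ⊢ A ⇒ (B ⇒ (C ∧ D))
  ∧-intro₂ p q = ·-curry (mp (adj (·-uncurry p) (·-uncurry q)) (ax-∧i _ _ _))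

  ∨-elim : ∀ {A B C} → ⊢ A ⇒ C → ⊢ B ⇒ C → ⊢ A ∨ B → ⊢ C
  ∨-elim p q d = mp d (mp (adj p q) (ax-∨e _ _ _))

  ¬𝟎⇒𝟏 : ⊢ ¬' 𝟎 ⇒ 𝟏
  ¬𝟎⇒𝟏 = ⇒-trans (⇒-antitoneˡ (mp ax-1 (⇒-apply 𝟏 𝟎))) (ax-dn 𝟏)

  excluded-middle-subunit : ∀ a → ⊢ a ∨ (¬' a ∧ 𝟏)
  excluded-middle-subunit a = ∨-elim (ax-∨r _ _) from-𝟎⇒a (ax-prl a 𝟎)
    where
    E : Fm
    E = (𝟎 ⇒ a) ∧ 𝟏
    a-case : ⊢ a ⇒ (E ⇒ (a ∨ (¬' a ∧ 𝟏)))
    a-case = ⇒-trans (⇒-weaken-subunit (ax-∧r _ _)) (⇒-monoʳ (ax-∨l _ _))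
    ¬a-subunit : ⊢ ¬' a ⇒ (E ⇒ 𝟏)
    ¬a-subunit = ⇒-trans (⇒-trans (⇒-exchange (ax-sfx 𝟎 a 𝟎)) (⇒-monoʳ ¬𝟎⇒𝟏))
                         (⇒-antitoneˡ (ax-∧l _ _))
    ¬a-case : ⊢ ¬' a ⇒ (E ⇒ (a ∨ (¬' a ∧ 𝟏)))
    ¬a-case = ⇒-trans (∧-intro₂ (⇒-weaken-subunit (ax-∧r _ _)) ¬a-subunit)
                      (⇒-monoʳ (ax-∨r _ _))
    from-𝟎⇒a : ⊢ E ⇒ (a ∨ (¬' a ∧ 𝟏))
    from-𝟎⇒a = ∨-elim a-case ¬a-case (ax-em a)

  𝟎⊕-elim : ∀ R → ⊢ (𝟎 ⊕ R) ⇒ R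
  𝟎⊕-elim R = mp (ax-id 𝟎) (⇒-apply (¬' 𝟎) R)

  ⊕𝟎-elim : ∀ {A R} → ⊢ R ⇒ 𝟎 → ⊢ (A ⊕ R) ⇒ A
  ⊕𝟎-elim {A} r = ⇒-trans (⇒-monoʳ r) (ax-dn A)

  ⊕-contrapose : ∀ S a → ⊢ (S ⊕ a) ⇒ (¬' a ⇒ S)
  ⊕-contrapose S a = ⇒-trans (ax-sfx (¬' S) a 𝟎) (⇒-monoʳ (ax-dn S))

  ⊕-assoc-contrapose : ∀ P a R → ⊢ ((P ⊕ a) ⊕ R) ⇒ (¬' a ⇒ (P ⊕ R))
  ⊕-assoc-contrapose P a R =
    ⇒-trans (⇒-exchange (ax-sfx _ _ _)) (⇒-antitoneˡ ¬a⇒¬P⇒¬[P⊕a])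
    where
    ¬P⇒[P⊕a]⇒¬¬a : ⊢ ¬' P ⇒ ((P ⊕ a) ⇒ (¬' a ⇒ 𝟎))
    ¬P⇒[P⊕a]⇒¬¬a = ⇒-trans (⇒-exchange (ax-id (P ⊕ a))) (⇒-monoʳ (⇒-apply a 𝟎))
    ¬a⇒¬P⇒¬[P⊕a] : ⊢ ¬' a ⇒ (¬' P ⇒ ¬' (P ⊕ a))
    ¬a⇒¬P⇒¬[P⊕a] = ⇒-exchange (⇒-trans ¬P⇒[P⊕a]⇒¬¬a (ax-perm _ _ _))

  -- The subunit context D is what lets successive case splits on
  -- excluded-middle-subunit be accumulated multiplicatively.
  SubunitEntails : Fm → Fm → Set
  SubunitEntails S Y = ∀ D → ⊢ D ⇒ 𝟏 → ⊢ D ⇒ S → ⊢ D ⇒ Y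

  ⇒-subunitEntails : ∀ {S Y} → ⊢ S ⇒ Y → SubunitEntails S Y
  ⇒-subunitEntails s D _ h = ⇒-trans h s

  subunitEntails-pre : ∀ {S S' Y} → ⊢ S ⇒ S' → SubunitEntails S' Y → SubunitEntails S Y
  subunitEntails-pre s g D d h = g D d (⇒-trans h s)

  subunitEntails-¬⇒ : ∀ {a S Y} → ⊢ a ⇒ Y → SubunitEntails S Y → SubunitEntails (¬' a ⇒ S) Y
  subunitEntails-¬⇒ {a} {S} {Y} aY g D d h = ∨-elim a-case ¬a-case (excluded-middle-subunit a)
    where
    E : Fm
    E = ¬' a ∧ 𝟏
    a-case : ⊢ a ⇒ (D ⇒ Y)
    a-case = ⇒-trans (⇒-weaken-subunit d) (⇒-monoʳ aY)
    D·E-subunit : ⊢ (D · E) ⇒ 𝟏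
    D·E-subunit = ·-uncurry (⇒-trans d (⇒-weaken-subunit (ax-∧r _ _)))
    D·E⇒S : ⊢ (D · E) ⇒ S
    D·E⇒S = ·-uncurry (⇒-trans h (⇒-antitoneˡ (ax-∧l _ _)))
    ¬a-case : ⊢ E ⇒ (D ⇒ Y)
    ¬a-case = ⇒-exchange (·-curry (g (D · E) D·E-subunit D·E⇒S))

  subunitEntails-⊗ : ∀ {a Y} → ⊢ a ⇒ Y → ∀ k → SubunitEntails (suc k ⊗ a) Y
  subunitEntails-⊗ aY zero = ⇒-subunitEntails (⇒-trans (𝟎⊕-elim _) aY)
  subunitEntails-⊗ {a} aY (suc k) =
    subunitEntails-pre (⊕-contrapose (suc k ⊗ a) a)
                       (subunitEntails-¬⇒ aY (subunitEntails-⊗ aY k))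

  subunitEntails-⊗⊕ : ∀ {a R Y} → ⊢ a ⇒ Y → SubunitEntails R Y
                    → ∀ k → SubunitEntails ((k ⊗ a) ⊕ R) Y
  subunitEntails-⊗⊕ {R = R} aY g zero = subunitEntails-pre (𝟎⊕-elim R) g
  subunitEntails-⊗⊕ {a} {R} aY g (suc k) =
    subunitEntails-pre (⊕-assoc-contrapose (k ⊗ a) a R)
                       (subunitEntails-¬⇒ aY (subunitEntails-⊗⊕ aY g k))

  ⇒-big∨ : ∀ m (φ : Fin (suc m) → Fm) i → ⊢ φ i ⇒ big _∨_ φ
  ⇒-big∨ zero    φ zero    = ax-id _
  ⇒-big∨ (suc m) φ zero    = ax-∨l _ _
  ⇒-big∨ (suc m) φ (suc i) = ⇒-trans (⇒-big∨ m (λ j → φ (suc j)) i) (ax-∨r _ _)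

  big⊕-zero⇒𝟎 : ∀ m (φ : Fin (suc m) → Fm) (λs : Fin (suc m) → ℕ) → (∀ i → λs i ≡ 0)
              → ⊢ big _⊕_ (λ i → λs i ⊗ φ i) ⇒ 𝟎
  big⊕-zero⇒𝟎 zero    φ λs z rewrite z zero = ax-id 𝟎
  big⊕-zero⇒𝟎 (suc m) φ λs z rewrite z zero =
    ⇒-trans (𝟎⊕-elim _) (big⊕-zero⇒𝟎 m (λ j → φ (suc j)) (λ j → λs (suc j)) (λ j → z (suc j)))

  subunitEntails-big⊕ : ∀ {Y} m (φ : Fin (suc m) → Fm) (λs : Fin (suc m) → ℕ)
                      → (∀ i → ⊢ φ i ⇒ Y)
                      → (∀ i → λs i ≡ 0) ⊎ SubunitEntails (big _⊕_ (λ i → λs i ⊗ φ i)) Y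
  subunitEntails-big⊕ zero φ λs φ⇒Y with λs zero in eq
  ... | zero  = inj₁ λ { zero → eq }
  ... | suc k = inj₂ (subunitEntails-⊗ (φ⇒Y zero) k)
  subunitEntails-big⊕ (suc m) φ λs φ⇒Y
    with subunitEntails-big⊕ m (λ j → φ (suc j)) (λ j → λs (suc j)) (λ j → φ⇒Y (suc j))
  ... | inj₂ tail = inj₂ (subunitEntails-⊗⊕ (φ⇒Y zero) tail (λs zero))
  ... | inj₁ tail-zero with λs zero in eq
  ...   | zero  = inj₁ λ { zero → eq ; (suc i) → tail-zero i }
  ...   | suc k = inj₂ (subunitEntails-pre
                         (⊕𝟎-elim (big⊕-zero⇒𝟎 m (λ j → φ (suc j)) (λ j → λs (suc j)) tail-zero))
                         (subunitEntails-⊗ (φ⇒Y zero) k))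

lemma3p2 : (_⊢_ : FmSet → Fm → Set) → ExtendsIUL⋆ _⊢_
    → (Σ' : FmSet) → (∀ ψ → Σ' ψ → IsMult ψ)
    → (m : ℕ) (φ : Fin (suc m) → Fm) → (∀ i → IsMult (φ i))
    → (λs : Fin (suc m) → ℕ) → Σ (Fin (suc m)) (λ i → λs i ≢ 0)
    → Σ' ⊢ big _⊕_ (λ i → λs i ⊗ φ i)
    → Σ' ⊢ big _∨_ φ
lemma3p2 _⊢_ ext Σ' _ m φ _ λs (i , λsᵢ≢0) ⊢sum =
  IsLogic.cut (ExtendsIUL⋆.isLogic ext) sum-derivable (ExtendsIUL⋆.contains ext sum⊢disj)
  where
  sum : Fm
  sum = big _⊕_ (λ i → λs i ⊗ φ i)
  ≡sum : FmSet
  ≡sum ψ = ψ ≡ sum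
  sum-derivable : ∀ ψ → ≡sum ψ → Σ' ⊢ ψ
  sum-derivable ψ refl = ⊢sum
  sum⊢disj : ≡sum ⊢IUL⋆ big _∨_ φ
  sum⊢disj with subunitEntails-big⊕ m φ λs (⇒-big∨ m φ)
  ... | inj₁ all-zero = ⊥-elim (λsᵢ≢0 (all-zero i))
  ... | inj₂ entails  = mp ax-1 (entails 𝟏 (ax-id 𝟏) (mp (assm refl) (ax-push sum)))
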